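{- Let $\frac{r}{s}>\frac{r'}{s'}$ be two rational numbers greater than $1$ (with $r,s$ and $r',s'$ coprime positive integers), and let $\frac{\mathcal R}{\mathcal S}=\left[\frac rs\right]_q$, $\frac{\mathcal R'}{\mathcal S'}=\left[\frac{r'}{s'}\right]_q$. Then $\mathcal R\mathcal S'-\mathcal S\mathcal R'=q^{\alpha}$ for some integer $\alpha\ge 0$ if and only if $rs'-r's=1$.
   Context: $q$ is a formal variable and $[a]_q=1+q+\cdots+q^{a-1}$ for a positive integer $a$. Every rational $r/s>1$ has a unique negative continued fraction expansion $r/s=\llbracket c_1,\ldots,c_k\rrbracket=c_1-\cfrac{1}{c_2-\cfrac{1}{\ddots-\cfrac{1}{c_k}}}$ with integers $c_i\ge 2$. Its $q$-deformation is the rational function $$\left[\tfrac{r}{s}\right]_q:=[c_1]_q-\cfrac{q^{c_1-1}}{[c_2]_q-\cfrac{q^{c_2-1}}{\ddots-\cfrac{q^{c_{k-1}-1}}{[c_k]_q}}},$$ written as $\frac{\mathcal R(q)}{\mathcal S(q)}$ with $\mathcal R,\mathcal S\in\mathbb Z[q]$ coprime and normalized by $\mathcal R(1)=r$, $\mathcal S(1)=s$. -}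

module Defs where

open import Data.Nat as ℕ using (ℕ; zero; suc; _≤_)
open import Data.Integer as ℤ using (ℤ; +_)
open import Data.List using (List; []; _∷_; map; replicate; foldr; _++_)
open import Data.List.Relation.Unary.All using (All)
open import Data.Product using (Σ; _×_; _,_; ∃)
open import Relation.Binary.PropositionalEquality using (_≡_)

-- Polynomials in ℤ[q] as coefficient lists (lowest degree first).

Poly : Set
Poly = List ℤ

coeff : Poly → ℕ → ℤ
coeff []       _       = + 0
coeff (a ∷ p)  zero    = a
coeff (a ∷ p)  (suc n) = coeff p n

-- Equality of polynomials: all coefficients agree (trailing zeros irrelevant).
infix 4 _≈ₚ_
_≈ₚ_ : Poly → Poly → Set
p ≈ₚ p' = ∀ n → coeff p n ≡ coeff p' n

infixl 6 _+ₚ_ _-ₚ_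
infixl 7 _*ₚ_

_+ₚ_ : Poly → Poly → Poly
[]      +ₚ p'       = p'
(a ∷ p) +ₚ []       = a ∷ p
(a ∷ p) +ₚ (b ∷ p') = (a ℤ.+ b) ∷ (p +ₚ p')

negₚ : Poly → Poly
negₚ = map (λ a → ℤ.- a)

_-ₚ_ : Poly → Poly → Poly
p -ₚ p' = p +ₚ negₚ p'

_*ₚ_ : Poly → Poly → Poly
[]      *ₚ p' = []
(a ∷ p) *ₚ p' = map (a ℤ.*_) p' +ₚ (+ 0 ∷ (p *ₚ p'))

oneₚ : Poly
oneₚ = + 1 ∷ []

qpow : ℕ → Poly
qpow α = replicate α (+ 0) ++ (+ 1 ∷ [])

qint : ℕ → Poly
qint a = replicate a (+ 1)

eval1 : Poly → ℤ
eval1 = foldr ℤ._+_ (+ 0)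

CoprimeP : Poly → Poly → Set
CoprimeP R S = ∀ d a b → a *ₚ d ≈ₚ R → b *ₚ d ≈ₚ S → ∃ λ u → u *ₚ d ≈ₚ oneₚ

-- Negative continued fractions ⟦c, c₂, …, c_k⟧ (nonempty: head c, tail cs),
-- evaluated as a (numerator , denominator) pair by fraction arithmetic:
--   ⟦c⟧ = c/1,   c - 1/(N/D) = (c N - D)/N.

cfℤ : ℕ → List ℕ → ℤ × ℤ
cfℤ c []       = (+ c , + 1)
cfℤ c (d ∷ ds) with cfℤ d ds
... | (N , D) = ((+ c) ℤ.* N ℤ.- D , N)

IsNegCF : ℕ → ℕ → ℕ → List ℕ → Set
IsNegCF r s c cs = All (2 ≤_) (c ∷ cs) × (N ℤ.* (+ s) ≡ (+ r) ℤ.* D)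
  where
  N = Data.Product.proj₁ (cfℤ c cs)
  D = Data.Product.proj₂ (cfℤ c cs)

-- q-deformed continued fraction:
--   [c]_q  (single entry),   [c]_q - q^(c-1)/(N/D) = ([c]_q N - q^(c-1) D)/N.
cfq : ℕ → List ℕ → Poly × Poly
cfq c []       = (qint c , oneₚ)
cfq c (d ∷ ds) with cfq d ds
... | (N , D) = (qint c *ₚ N -ₚ qpow (ℕ.pred c) *ₚ D , N)

QRat : ℕ → ℕ → Poly → Poly → Set
QRat r s R S =
  Σ ℕ λ c → Σ (List ℕ) λ cs →
    IsNegCF r s c cs ×
    (R *ₚ Data.Product.proj₂ (cfq c cs) ≈ₚ S *ₚ Data.Product.proj₁ (cfq c cs)) ×
    CoprimeP R S ×
    eval1 R ≡ + r ×
    eval1 S ≡ + s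

-- Evaluating at q = 1 maps R S′ − S R′ to r s′ − r′ s, which gives one direction. Conversely,
-- [r/s]_q is exactly the pair (N, D) produced by the q-deformed continued-fraction recursion.
-- Writing r/s = ⟦c, cs⟧ with c = ⌈r/s⌉, the condition r s′ − r′ s = 1 forces either equal leading
-- entries, the tails again satisfying the condition, or r′/s′ = c′ and r/s = ⟦c′ + 1, cs⟧ with ⟦cs⟧
-- and 1 = ⟦1⟧ satisfying it; in each case the q-determinant is a power of q times the
-- q-determinant of the smaller pair.

module Submission where

open import Defs
open import Data.Nat using (ℕ; _<_; _≤_; _*_)
open import Data.Nat.Coprimality using (Coprime)
open import Data.Integer using (+_; _-_)
open import Data.Product using (∃; _×_)
open import Function.Bundles using (_⇔_)
open import Relation.Binary.PropositionalEquality using (_≡_)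

open import Algebra.Bundles using (CommutativeRing)
open import Data.Integer as ℤ using (ℤ)
import Data.Integer.Properties as ℤ
open import Data.Integer.Tactic.RingSolver using () renaming (solve-∀ to ℤ-solve-∀)
open import Data.List using (List; []; _∷_; map)
open import Data.List.Relation.Unary.All using (All; []; _∷_)
open import Data.Maybe using (Maybe; just; nothing)
open import Data.Nat using (zero; suc; z≤n; s≤s; _+_; _∸_; pred; NonZero; >-nonZero; >-nonZero⁻¹; ≢-nonZero⁻¹)
open import Data.Nat.Properties
open import Data.Nat.Tactic.RingSolver using (solve-∀)
open import Data.Product using (_,_; proj₁; proj₂; map₁; map₂)
open import Data.Sum using (_⊎_; inj₁; inj₂; [_,_]′) renaming (map to ⊎-map)
open import Function using (flip)
open import Function.Bundles using (mk⇔)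
open import Relation.Binary.Bundles using (Setoid)
open import Relation.Binary.PropositionalEquality
import Relation.Binary.Reasoning.Setoid as SetoidReasoning
open import Relation.Nullary using (yes; no; ¬_; contradiction)

-- The ring ℤ[q]

coeff-+ₚ : ∀ p t n → coeff (p +ₚ t) n ≡ coeff p n ℤ.+ coeff t n
coeff-+ₚ []      t       n       = sym (ℤ.+-identityˡ _)
coeff-+ₚ (a ∷ p) []      n       = sym (ℤ.+-identityʳ _)
coeff-+ₚ (a ∷ p) (b ∷ t) zero    = refl
coeff-+ₚ (a ∷ p) (b ∷ t) (suc n) = coeff-+ₚ p t n

coeff-negₚ : ∀ p n → coeff (negₚ p) n ≡ ℤ.- coeff p n
coeff-negₚ []      n       = refl
coeff-negₚ (a ∷ p) zero    = refl
coeff-negₚ (a ∷ p) (suc n) = coeff-negₚ p n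

scaleₚ : ℤ → Poly → Poly
scaleₚ a = map (a ℤ.*_)

coeff-scaleₚ : ∀ a p n → coeff (scaleₚ a p) n ≡ a ℤ.* coeff p n
coeff-scaleₚ a []      n       = sym (ℤ.*-zeroʳ a)
coeff-scaleₚ a (b ∷ p) zero    = refl
coeff-scaleₚ a (b ∷ p) (suc n) = coeff-scaleₚ a p n

-- _≈ₚ_ wrapped in a record, so that p and t can be inferred from a proof of p ≋ t.
infix 4 _≋_
record _≋_ (p t : Poly) : Set where
  constructor mk≋
  field coeff-≡ : p ≈ₚ t
open _≋_ public

≋-refl : ∀ {p} → p ≋ p
≋-refl = mk≋ λ _ → refl

≋-sym : ∀ {p t} → p ≋ t → t ≋ p
≋-sym (mk≋ h) = mk≋ λ n → sym (h n)

≋-trans : ∀ {p t u} → p ≋ t → t ≋ u → p ≋ u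
≋-trans (mk≋ h) (mk≋ h′) = mk≋ λ n → trans (h n) (h′ n)

≋-setoid : Setoid _ _
≋-setoid = record
  { Carrier = Poly ; _≈_ = _≋_
  ; isEquivalence = record { refl = ≋-refl ; sym = ≋-sym ; trans = ≋-trans } }


∷-cong : ∀ {a b p t} → a ≡ b → p ≋ t → a ∷ p ≋ b ∷ t
∷-cong a≡b (mk≋ h) = mk≋ λ { zero → a≡b ; (suc n) → h n }

∷-injectiveʳ : ∀ {a b p t} → a ∷ p ≋ b ∷ t → p ≋ t
∷-injectiveʳ (mk≋ h) = mk≋ λ n → h (suc n)

+ₚ-cong : ∀ {p p′ t t′} → p ≋ p′ → t ≋ t′ → p +ₚ t ≋ p′ +ₚ t′
+ₚ-cong {p} {p′} {t} {t′} (mk≋ h) (mk≋ h′) = mk≋ λ n → begin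
  coeff (p +ₚ t) n              ≡⟨ coeff-+ₚ p t n ⟩
  coeff p n ℤ.+ coeff t n       ≡⟨ cong₂ ℤ._+_ (h n) (h′ n) ⟩
  coeff p′ n ℤ.+ coeff t′ n     ≡⟨ coeff-+ₚ p′ t′ n ⟨
  coeff (p′ +ₚ t′) n            ∎
  where open ≡-Reasoning

negₚ-cong : ∀ {p p′} → p ≋ p′ → negₚ p ≋ negₚ p′
negₚ-cong {p} {p′} (mk≋ h) = mk≋ λ n → begin
  coeff (negₚ p) n    ≡⟨ coeff-negₚ p n ⟩
  ℤ.- coeff p n       ≡⟨ cong ℤ.-_ (h n) ⟩
  ℤ.- coeff p′ n      ≡⟨ coeff-negₚ p′ n ⟨
  coeff (negₚ p′) n   ∎
  where open ≡-Reasoning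

+ₚ-assoc : ∀ p t u → (p +ₚ t) +ₚ u ≋ p +ₚ (t +ₚ u)
+ₚ-assoc p t u = mk≋ λ n → begin
  coeff ((p +ₚ t) +ₚ u) n                    ≡⟨ coeff-+ₚ (p +ₚ t) u n ⟩
  coeff (p +ₚ t) n ℤ.+ coeff u n             ≡⟨ cong (ℤ._+ coeff u n) (coeff-+ₚ p t n) ⟩
  (coeff p n ℤ.+ coeff t n) ℤ.+ coeff u n    ≡⟨ ℤ.+-assoc (coeff p n) (coeff t n) (coeff u n) ⟩
  coeff p n ℤ.+ (coeff t n ℤ.+ coeff u n)    ≡⟨ cong (λ x → coeff p n ℤ.+ x) (coeff-+ₚ t u n) ⟨
  coeff p n ℤ.+ coeff (t +ₚ u) n             ≡⟨ coeff-+ₚ p (t +ₚ u) n ⟨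
  coeff (p +ₚ (t +ₚ u)) n                    ∎
  where open ≡-Reasoning

+ₚ-comm : ∀ p t → p +ₚ t ≋ t +ₚ p
+ₚ-comm p t = mk≋ λ n → begin
  coeff (p +ₚ t) n          ≡⟨ coeff-+ₚ p t n ⟩
  coeff p n ℤ.+ coeff t n   ≡⟨ ℤ.+-comm (coeff p n) (coeff t n) ⟩
  coeff t n ℤ.+ coeff p n   ≡⟨ coeff-+ₚ t p n ⟨
  coeff (t +ₚ p) n          ∎
  where open ≡-Reasoning

+ₚ-identityʳ : ∀ p → p +ₚ [] ≋ p
+ₚ-identityʳ p = mk≋ λ n → trans (coeff-+ₚ p [] n) (ℤ.+-identityʳ (coeff p n))

+ₚ-inverseˡ : ∀ p → negₚ p +ₚ p ≋ []
+ₚ-inverseˡ p = mk≋ λ n → begin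
  coeff (negₚ p +ₚ p) n              ≡⟨ coeff-+ₚ (negₚ p) p n ⟩
  coeff (negₚ p) n ℤ.+ coeff p n     ≡⟨ cong (ℤ._+ coeff p n) (coeff-negₚ p n) ⟩
  ℤ.- coeff p n ℤ.+ coeff p n        ≡⟨ ℤ.+-inverseˡ (coeff p n) ⟩
  + 0                                ∎
  where open ≡-Reasoning

+ₚ-inverseʳ : ∀ p → p +ₚ negₚ p ≋ []
+ₚ-inverseʳ p = ≋-trans (+ₚ-comm p (negₚ p)) (+ₚ-inverseˡ p)

scaleₚ-cong : ∀ a {p p′} → p ≋ p′ → scaleₚ a p ≋ scaleₚ a p′
scaleₚ-cong a {p} {p′} (mk≋ h) = mk≋ λ n →
  trans (coeff-scaleₚ a p n) (trans (cong (a ℤ.*_) (h n)) (sym (coeff-scaleₚ a p′ n)))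

scaleₚ-distrib-+ₚ : ∀ a p t → scaleₚ a (p +ₚ t) ≋ scaleₚ a p +ₚ scaleₚ a t
scaleₚ-distrib-+ₚ a p t = mk≋ λ n → begin
  coeff (scaleₚ a (p +ₚ t)) n                           ≡⟨ coeff-scaleₚ a (p +ₚ t) n ⟩
  a ℤ.* coeff (p +ₚ t) n                                ≡⟨ cong (a ℤ.*_) (coeff-+ₚ p t n) ⟩
  a ℤ.* (coeff p n ℤ.+ coeff t n)                       ≡⟨ ℤ.*-distribˡ-+ a (coeff p n) (coeff t n) ⟩
  a ℤ.* coeff p n ℤ.+ a ℤ.* coeff t n                   ≡⟨ cong₂ ℤ._+_ (coeff-scaleₚ a p n) (coeff-scaleₚ a t n) ⟨
  coeff (scaleₚ a p) n ℤ.+ coeff (scaleₚ a t) n         ≡⟨ coeff-+ₚ (scaleₚ a p) (scaleₚ a t) n ⟨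
  coeff (scaleₚ a p +ₚ scaleₚ a t) n                    ∎
  where open ≡-Reasoning

scaleₚ-zero : ∀ p → scaleₚ (+ 0) p ≋ []
scaleₚ-zero p = mk≋ (coeff-scaleₚ (+ 0) p)

scaleₚ-identity : ∀ p → scaleₚ (+ 1) p ≋ p
scaleₚ-identity p = mk≋ λ n → trans (coeff-scaleₚ (+ 1) p n) (ℤ.*-identityˡ (coeff p n))

scaleₚ-scaleₚ : ∀ a b p → scaleₚ (a ℤ.* b) p ≋ scaleₚ a (scaleₚ b p)
scaleₚ-scaleₚ a b p = mk≋ λ n → begin
  coeff (scaleₚ (a ℤ.* b) p) n          ≡⟨ coeff-scaleₚ (a ℤ.* b) p n ⟩
  a ℤ.* b ℤ.* coeff p n                 ≡⟨ ℤ.*-assoc a b (coeff p n) ⟩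
  a ℤ.* (b ℤ.* coeff p n)               ≡⟨ cong (a ℤ.*_) (coeff-scaleₚ b p n) ⟨
  a ℤ.* coeff (scaleₚ b p) n            ≡⟨ coeff-scaleₚ a (scaleₚ b p) n ⟨
  coeff (scaleₚ a (scaleₚ b p)) n       ∎
  where open ≡-Reasoning

+ₚ-left-comm : ∀ p t u → p +ₚ (t +ₚ u) ≋ t +ₚ (p +ₚ u)
+ₚ-left-comm p t u = begin
  p +ₚ (t +ₚ u)   ≈⟨ +ₚ-assoc p t u ⟨
  (p +ₚ t) +ₚ u   ≈⟨ +ₚ-cong (+ₚ-comm p t) (≋-refl {u}) ⟩
  (t +ₚ p) +ₚ u   ≈⟨ +ₚ-assoc t p u ⟩
  t +ₚ (p +ₚ u)   ∎
  where open SetoidReasoning ≋-setoid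

+ₚ-interchange : ∀ p t u v → (p +ₚ t) +ₚ (u +ₚ v) ≋ (p +ₚ u) +ₚ (t +ₚ v)
+ₚ-interchange p t u v = begin
  (p +ₚ t) +ₚ (u +ₚ v)   ≈⟨ +ₚ-assoc p t (u +ₚ v) ⟩
  p +ₚ (t +ₚ (u +ₚ v))   ≈⟨ +ₚ-cong (≋-refl {p}) (+ₚ-left-comm t u v) ⟩
  p +ₚ (u +ₚ (t +ₚ v))   ≈⟨ +ₚ-assoc p u (t +ₚ v) ⟨
  (p +ₚ u) +ₚ (t +ₚ v)   ∎
  where open SetoidReasoning ≋-setoid

0∷-≋[] : ∀ {p} → p ≋ [] → + 0 ∷ p ≋ []
0∷-≋[] (mk≋ h) = mk≋ λ { zero → refl ; (suc n) → h n }

*ₚ-zeroʳ : ∀ p → p *ₚ [] ≋ []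
*ₚ-zeroʳ []      = ≋-refl
*ₚ-zeroʳ (a ∷ p) = 0∷-≋[] (*ₚ-zeroʳ p)

*ₚ-identityˡ : ∀ p → oneₚ *ₚ p ≋ p
*ₚ-identityˡ p = ≋-trans (+ₚ-cong (scaleₚ-identity p) (0∷-≋[] ≋-refl)) (+ₚ-identityʳ p)

0∷-*ₚ : ∀ p t → (+ 0 ∷ p) *ₚ t ≋ + 0 ∷ (p *ₚ t)
0∷-*ₚ p t = +ₚ-cong (scaleₚ-zero t) ≋-refl

≋[]-*ₚ : ∀ {p} t → p ≋ [] → p *ₚ t ≋ []
≋[]-*ₚ {[]}    t _ = ≋-refl
≋[]-*ₚ {a ∷ p} t (mk≋ h) with h 0
... | refl = +ₚ-cong (scaleₚ-zero t) (0∷-≋[] (≋[]-*ₚ {p} t (mk≋ λ n → h (suc n))))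

*ₚ-congˡ : ∀ {p p′} t → p ≋ p′ → p *ₚ t ≋ p′ *ₚ t
*ₚ-congˡ {[]}    {[]}     t _ = ≋-refl
*ₚ-congˡ {[]}    {b ∷ p′} t h = ≋-sym (≋[]-*ₚ t (≋-sym h))
*ₚ-congˡ {a ∷ p} {[]}     t h = ≋[]-*ₚ t h
*ₚ-congˡ {a ∷ p} {b ∷ p′} t h@(mk≋ h′) with h′ 0
... | refl = +ₚ-cong ≋-refl (∷-cong refl (*ₚ-congˡ t (∷-injectiveʳ h)))

*ₚ-congʳ : ∀ p {t t′} → t ≋ t′ → p *ₚ t ≋ p *ₚ t′
*ₚ-congʳ []      _ = ≋-refl
*ₚ-congʳ (a ∷ p) h = +ₚ-cong (scaleₚ-cong a h) (∷-cong refl (*ₚ-congʳ p h))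

*ₚ-cong : ∀ {p p′ t t′} → p ≋ p′ → t ≋ t′ → p *ₚ t ≋ p′ *ₚ t′
*ₚ-cong {p′ = p′} {t} h h′ = ≋-trans (*ₚ-congˡ t h) (*ₚ-congʳ p′ h′)

*ₚ-∷ʳ : ∀ p b t → p *ₚ (b ∷ t) ≋ scaleₚ b p +ₚ (+ 0 ∷ p *ₚ t)
*ₚ-∷ʳ []      b t = ≋-sym (0∷-≋[] ≋-refl)
*ₚ-∷ʳ (a ∷ p) b t = begin
  (a ℤ.* b ∷ scaleₚ a t) +ₚ (+ 0 ∷ p *ₚ (b ∷ t))
    ≈⟨ ∷-cong (ℤ.+-identityʳ _) (+ₚ-cong (≋-refl {scaleₚ a t}) (*ₚ-∷ʳ p b t)) ⟩
  a ℤ.* b ∷ (scaleₚ a t +ₚ (scaleₚ b p +ₚ (+ 0 ∷ p *ₚ t)))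
    ≈⟨ ∷-cong (ℤ.*-comm a b) (+ₚ-left-comm (scaleₚ a t) (scaleₚ b p) (+ 0 ∷ p *ₚ t)) ⟩
  b ℤ.* a ∷ (scaleₚ b p +ₚ (scaleₚ a t +ₚ (+ 0 ∷ p *ₚ t)))
    ≈⟨ ∷-cong (sym (ℤ.+-identityʳ _)) ≋-refl ⟩
  (b ℤ.* a ∷ scaleₚ b p) +ₚ (+ 0 ∷ (scaleₚ a t +ₚ (+ 0 ∷ p *ₚ t)))
    ∎
  where open SetoidReasoning ≋-setoid

*ₚ-comm : ∀ p t → p *ₚ t ≋ t *ₚ p
*ₚ-comm []      t = ≋-sym (*ₚ-zeroʳ t)
*ₚ-comm (a ∷ p) t = ≋-trans (+ₚ-cong ≋-refl (∷-cong refl (*ₚ-comm p t))) (≋-sym (*ₚ-∷ʳ t a p))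

*ₚ-distribˡ-+ₚ : ∀ u p t → u *ₚ (p +ₚ t) ≋ u *ₚ p +ₚ u *ₚ t
*ₚ-distribˡ-+ₚ []      p t = ≋-refl
*ₚ-distribˡ-+ₚ (a ∷ u) p t = ≋-trans
  (+ₚ-cong (scaleₚ-distrib-+ₚ a p t) (∷-cong refl (*ₚ-distribˡ-+ₚ u p t)))
  (+ₚ-interchange (scaleₚ a p) (scaleₚ a t) (+ 0 ∷ u *ₚ p) (+ 0 ∷ u *ₚ t))

*ₚ-distribʳ-+ₚ : ∀ u p t → (p +ₚ t) *ₚ u ≋ p *ₚ u +ₚ t *ₚ u
*ₚ-distribʳ-+ₚ u p t = begin
  (p +ₚ t) *ₚ u       ≈⟨ *ₚ-comm (p +ₚ t) u ⟩
  u *ₚ (p +ₚ t)       ≈⟨ *ₚ-distribˡ-+ₚ u p t ⟩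
  u *ₚ p +ₚ u *ₚ t    ≈⟨ +ₚ-cong (*ₚ-comm u p) (*ₚ-comm u t) ⟩
  p *ₚ u +ₚ t *ₚ u    ∎
  where open SetoidReasoning ≋-setoid

scaleₚ-*ₚ : ∀ a p t → scaleₚ a p *ₚ t ≋ scaleₚ a (p *ₚ t)
scaleₚ-*ₚ a []      t = ≋-refl
scaleₚ-*ₚ a (b ∷ p) t = begin
  scaleₚ (a ℤ.* b) t +ₚ (+ 0 ∷ scaleₚ a p *ₚ t)
    ≈⟨ +ₚ-cong (scaleₚ-scaleₚ a b t) (∷-cong (sym (ℤ.*-zeroʳ a)) (scaleₚ-*ₚ a p t)) ⟩
  scaleₚ a (scaleₚ b t) +ₚ scaleₚ a (+ 0 ∷ p *ₚ t)
    ≈⟨ scaleₚ-distrib-+ₚ a (scaleₚ b t) (+ 0 ∷ p *ₚ t) ⟨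
  scaleₚ a (scaleₚ b t +ₚ (+ 0 ∷ p *ₚ t))
    ∎
  where open SetoidReasoning ≋-setoid

*ₚ-assoc : ∀ p t u → (p *ₚ t) *ₚ u ≋ p *ₚ (t *ₚ u)
*ₚ-assoc []      t u = ≋-refl
*ₚ-assoc (a ∷ p) t u = begin
  (scaleₚ a t +ₚ (+ 0 ∷ p *ₚ t)) *ₚ u          ≈⟨ *ₚ-distribʳ-+ₚ u (scaleₚ a t) _ ⟩
  scaleₚ a t *ₚ u +ₚ (+ 0 ∷ p *ₚ t) *ₚ u       ≈⟨ +ₚ-cong (scaleₚ-*ₚ a t u) (0∷-*ₚ (p *ₚ t) u) ⟩
  scaleₚ a (t *ₚ u) +ₚ (+ 0 ∷ (p *ₚ t) *ₚ u)   ≈⟨ +ₚ-cong (≋-refl {scaleₚ a (t *ₚ u)}) (∷-cong refl (*ₚ-assoc p t u)) ⟩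
  scaleₚ a (t *ₚ u) +ₚ (+ 0 ∷ p *ₚ (t *ₚ u))   ∎
  where open SetoidReasoning ≋-setoid

*ₚ-identityʳ : ∀ p → p *ₚ oneₚ ≋ p
*ₚ-identityʳ p = ≋-trans (*ₚ-comm p oneₚ) (*ₚ-identityˡ p)

polyCommutativeRing : CommutativeRing _ _
polyCommutativeRing = record
  { Carrier = Poly ; _≈_ = _≋_ ; _+_ = _+ₚ_ ; _*_ = _*ₚ_ ; -_ = negₚ ; 0# = [] ; 1# = oneₚ
  ; isCommutativeRing = record
    { isRing = record
      { +-isAbelianGroup = record
        { isGroup = record
          { isMonoid = record
            { isSemigroup = record
              { isMagma = record
                { isEquivalence = Setoid.isEquivalence ≋-setoid
                ; ∙-cong = +ₚ-cong }
              ; assoc = +ₚ-assoc }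
            ; identity = (λ _ → ≋-refl) , +ₚ-identityʳ }
          ; inverse = +ₚ-inverseˡ , +ₚ-inverseʳ
          ; ⁻¹-cong = negₚ-cong }
        ; comm = +ₚ-comm }
      ; *-cong = *ₚ-cong
      ; *-assoc = *ₚ-assoc
      ; *-identity = *ₚ-identityˡ , *ₚ-identityʳ
      ; distrib = *ₚ-distribˡ-+ₚ , *ₚ-distribʳ-+ₚ }
    ; *-comm = *ₚ-comm } }

module PolyRingSolver where
  open import Algebra.Solver.Ring.AlmostCommutativeRing
    using (fromCommutativeRing; _-Raw-AlmostCommutative⟶_)

  constₚ : CommutativeRing.rawRing ℤ.+-*-commutativeRing -Raw-AlmostCommutative⟶ fromCommutativeRing polyCommutativeRing
  constₚ = record
    { ⟦_⟧    = λ a → a ∷ []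
    ; +-homo = λ _ _ → ≋-refl
    ; *-homo = λ _ _ → ∷-cong (sym (ℤ.+-identityʳ _)) ≋-refl
    ; -‿homo = λ _ → ≋-refl
    ; 0-homo = 0∷-≋[] ≋-refl
    ; 1-homo = ≋-refl
    }

  constₚ-≟ : ∀ a b → Maybe (a ∷ [] ≋ b ∷ [])
  constₚ-≟ a b with a ℤ.≟ b
  ... | yes refl = just ≋-refl
  ... | no _     = nothing

  open import Algebra.Solver.Ring _ _ constₚ constₚ-≟ public

open PolyRingSolver using (solve; _:+_; _:*_; _:-_; :-_; con; _:=_)

-- q-integers and evaluation at q = 1

qint-suc : ∀ k → qint (suc k) ≋ qint k +ₚ qpow k
qint-suc zero    = ≋-refl
qint-suc (suc k) = ∷-cong refl (qint-suc k)

qpow-+ : ∀ a b → qpow a *ₚ qpow b ≋ qpow (a + b)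
qpow-+ zero    b = *ₚ-identityˡ (qpow b)
qpow-+ (suc a) b = ≋-trans (0∷-*ₚ (qpow a) (qpow b)) (∷-cong refl (qpow-+ a b))

eval1-+ₚ : ∀ p t → eval1 (p +ₚ t) ≡ eval1 p ℤ.+ eval1 t
eval1-+ₚ []      t       = sym (ℤ.+-identityˡ (eval1 t))
eval1-+ₚ (a ∷ p) []      = sym (ℤ.+-identityʳ (eval1 (a ∷ p)))
eval1-+ₚ (a ∷ p) (b ∷ t) = begin
  (a ℤ.+ b) ℤ.+ eval1 (p +ₚ t)             ≡⟨ cong (ℤ._+_ (a ℤ.+ b)) (eval1-+ₚ p t) ⟩
  (a ℤ.+ b) ℤ.+ (eval1 p ℤ.+ eval1 t)      ≡⟨ interchange a b (eval1 p) (eval1 t) ⟩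
  (a ℤ.+ eval1 p) ℤ.+ (b ℤ.+ eval1 t)      ∎
  where
  open ≡-Reasoning
  open import Algebra.Properties.CommutativeSemigroup ℤ.+-commutativeSemigroup using (interchange)

eval1-negₚ : ∀ p → eval1 (negₚ p) ≡ ℤ.- eval1 p
eval1-negₚ []      = refl
eval1-negₚ (a ∷ p) = trans (cong (ℤ._+_ (ℤ.- a)) (eval1-negₚ p)) (sym (ℤ.neg-distrib-+ a (eval1 p)))

eval1-scaleₚ : ∀ a p → eval1 (scaleₚ a p) ≡ a ℤ.* eval1 p
eval1-scaleₚ a []      = sym (ℤ.*-zeroʳ a)
eval1-scaleₚ a (b ∷ p) = trans (cong (ℤ._+_ (a ℤ.* b)) (eval1-scaleₚ a p)) (sym (ℤ.*-distribˡ-+ a b (eval1 p)))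

eval1-*ₚ : ∀ p t → eval1 (p *ₚ t) ≡ eval1 p ℤ.* eval1 t
eval1-*ₚ []      t = sym (ℤ.*-zeroˡ (eval1 t))
eval1-*ₚ (a ∷ p) t = begin
  eval1 (scaleₚ a t +ₚ (+ 0 ∷ p *ₚ t))           ≡⟨ eval1-+ₚ (scaleₚ a t) (+ 0 ∷ p *ₚ t) ⟩
  eval1 (scaleₚ a t) ℤ.+ (+ 0 ℤ.+ eval1 (p *ₚ t)) ≡⟨ cong₂ ℤ._+_ (eval1-scaleₚ a t) (ℤ.+-identityˡ _) ⟩
  a ℤ.* eval1 t ℤ.+ eval1 (p *ₚ t)               ≡⟨ cong (ℤ._+_ (a ℤ.* eval1 t)) (eval1-*ₚ p t) ⟩
  a ℤ.* eval1 t ℤ.+ eval1 p ℤ.* eval1 t          ≡⟨ ℤ.*-distribʳ-+ (eval1 t) a (eval1 p) ⟨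
  (a ℤ.+ eval1 p) ℤ.* eval1 t                    ∎
  where open ≡-Reasoning

eval1-cong : ∀ {p t} → p ≋ t → eval1 p ≡ eval1 t
eval1-cong {[]}    {[]}    _ = refl
eval1-cong {[]}    {b ∷ t} h = cong₂ ℤ._+_ (coeff-≡ h 0) (eval1-cong {[]} {t} (mk≋ λ n → coeff-≡ h (suc n)))
eval1-cong {a ∷ p} {[]}    h = cong₂ ℤ._+_ (coeff-≡ h 0) (eval1-cong {p} {[]} (mk≋ λ n → coeff-≡ h (suc n)))
eval1-cong {a ∷ p} {b ∷ t} h = cong₂ ℤ._+_ (coeff-≡ h 0) (eval1-cong (∷-injectiveʳ h))

eval1-qint : ∀ c → eval1 (qint c) ≡ + c
eval1-qint zero    = refl
eval1-qint (suc c) = cong (ℤ._+_ (+ 1)) (eval1-qint c)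

eval1-qpow : ∀ m → eval1 (qpow m) ≡ + 1
eval1-qpow zero    = refl
eval1-qpow (suc m) = cong (ℤ._+_ (+ 0)) (eval1-qpow m)

-- Cancellation and units

tailₚ : Poly → Poly
tailₚ []      = []
tailₚ (_ ∷ p) = p

coeff-tailₚ : ∀ p n → coeff (tailₚ p) n ≡ coeff p (suc n)
coeff-tailₚ []      n = refl
coeff-tailₚ (_ ∷ p) n = refl

≋-0∷-tailₚ : ∀ p → coeff p 0 ≡ + 0 → p ≋ + 0 ∷ tailₚ p
≋-0∷-tailₚ []      _    = ≋-sym (0∷-≋[] ≋-refl)
≋-0∷-tailₚ (a ∷ p) a≡0 = ∷-cong a≡0 ≋-refl

coeff₀-*ₚ : ∀ p t → coeff (p *ₚ t) 0 ≡ coeff p 0 ℤ.* coeff t 0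
coeff₀-*ₚ []      t = sym (ℤ.*-zeroˡ (coeff t 0))
coeff₀-*ₚ (a ∷ p) t = trans (coeff-+ₚ (scaleₚ a t) (+ 0 ∷ p *ₚ t) 0)
                            (trans (ℤ.+-identityʳ _) (coeff-scaleₚ a t 0))

*ₚ-0∷ : ∀ p t → p *ₚ (+ 0 ∷ t) ≋ + 0 ∷ (p *ₚ t)
*ₚ-0∷ p t = begin
  p *ₚ (+ 0 ∷ t)    ≈⟨ *ₚ-comm p (+ 0 ∷ t) ⟩
  (+ 0 ∷ t) *ₚ p    ≈⟨ 0∷-*ₚ t p ⟩
  + 0 ∷ (t *ₚ p)    ≈⟨ ∷-cong refl (*ₚ-comm t p) ⟩
  + 0 ∷ (p *ₚ t)    ∎
  where open SetoidReasoning ≋-setoid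

-- A polynomial P with P(0) = 1 is not divisible by q, so q can be cancelled against it.
module ConstantTermOne {P : Poly} (P₀≡1 : coeff P 0 ≡ + 1) where

  coeff₀-P*ₚ : ∀ W → coeff (P *ₚ W) 0 ≡ coeff W 0
  coeff₀-P*ₚ W = begin
    coeff (P *ₚ W) 0            ≡⟨ coeff₀-*ₚ P W ⟩
    coeff P 0 ℤ.* coeff W 0     ≡⟨ cong (ℤ._* coeff W 0) P₀≡1 ⟩
    + 1 ℤ.* coeff W 0           ≡⟨ ℤ.*-identityˡ (coeff W 0) ⟩
    coeff W 0                   ∎
    where open ≡-Reasoning

  *ₚ-≋-0∷⇒tailₚ : ∀ {W Y} → P *ₚ W ≋ + 0 ∷ Y → P *ₚ tailₚ W ≋ Y
  *ₚ-≋-0∷⇒tailₚ {W} {Y} h = ∷-injectiveʳ (begin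
    + 0 ∷ P *ₚ tailₚ W   ≈⟨ *ₚ-0∷ P (tailₚ W) ⟨
    P *ₚ (+ 0 ∷ tailₚ W) ≈⟨ *ₚ-congʳ P (≋-0∷-tailₚ W (trans (sym (coeff₀-P*ₚ W)) (coeff-≡ h 0))) ⟨
    P *ₚ W               ≈⟨ h ⟩
    + 0 ∷ Y              ∎)
    where open SetoidReasoning ≋-setoid

  *ₚ-qpow-cancel : ∀ m {W Y} → P *ₚ W ≋ qpow m *ₚ Y → ∃ λ V → P *ₚ V ≋ Y
  *ₚ-qpow-cancel zero    {W} {Y} h = W , ≋-trans h (*ₚ-identityˡ Y)
  *ₚ-qpow-cancel (suc m) {W} {Y} h =
    *ₚ-qpow-cancel m (*ₚ-≋-0∷⇒tailₚ (≋-trans h (0∷-*ₚ (qpow m) Y)))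

  *ₚ-≋[]⇒≋[] : ∀ {X} → P *ₚ X ≋ [] → X ≋ []
  *ₚ-≋[]⇒≋[] {X} h = mk≋ (vanish X h)
    where
    vanish : ∀ X → P *ₚ X ≋ [] → ∀ n → coeff X n ≡ + 0
    vanish X h zero    = trans (sym (coeff₀-P*ₚ X)) (coeff-≡ h 0)
    vanish X h (suc n) = trans (sym (coeff-tailₚ X n))
      (vanish (tailₚ X) (*ₚ-≋-0∷⇒tailₚ (≋-trans h (≋-sym (0∷-≋[] ≋-refl)))) n)

  *ₚ-cancelˡ : ∀ {X Y} → P *ₚ X ≋ P *ₚ Y → X ≋ Y
  *ₚ-cancelˡ {X} {Y} h = begin
    X                   ≈⟨ difference-lemma X Y ⟩
    (X -ₚ Y) +ₚ Y       ≈⟨ +ₚ-cong (*ₚ-≋[]⇒≋[] P*[X-Y]≋[]) (≋-refl {Y}) ⟩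
    [] +ₚ Y             ∎
    where
    open SetoidReasoning ≋-setoid
    difference-lemma : ∀ X Y → X ≋ (X -ₚ Y) +ₚ Y
    difference-lemma = solve 2 (λ X Y → X := (X :- Y) :+ Y) ≋-refl
    *ₚ-distrib-minus : ∀ P X Y → P *ₚ (X -ₚ Y) ≋ P *ₚ X -ₚ P *ₚ Y
    *ₚ-distrib-minus = solve 3 (λ P X Y → P :* (X :- Y) := P :* X :- P :* Y) ≋-refl
    P*[X-Y]≋[] : P *ₚ (X -ₚ Y) ≋ []
    P*[X-Y]≋[] = ≋-trans (*ₚ-distrib-minus P X Y) (≋-trans (+ₚ-cong h (≋-refl {negₚ (P *ₚ Y)})) (+ₚ-inverseʳ (P *ₚ Y)))

HasDegree : Poly → ℕ → Set
HasDegree p d = coeff p d ≢ + 0 × (∀ n → d < n → coeff p n ≡ + 0)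

≋[]⊎HasDegree : ∀ p → p ≋ [] ⊎ ∃ (HasDegree p)
≋[]⊎HasDegree []      = inj₁ ≋-refl
≋[]⊎HasDegree (a ∷ p) with ≋[]⊎HasDegree p
... | inj₂ (d , p[d]≢0 , p-vanish) = inj₂ (suc d , p[d]≢0 , λ { (suc n) (s≤s d<n) → p-vanish n d<n })
... | inj₁ p≋[] with a ℤ.≟ + 0
...   | yes a≡0 = inj₁ (≋-trans (∷-cong a≡0 p≋[]) (0∷-≋[] ≋-refl))
...   | no  a≢0 = inj₂ (0 , a≢0 , λ { (suc n) _ → coeff-≡ p≋[] n })

coeff-*ₚ-top : ∀ p t a b → (∀ n → a < n → coeff p n ≡ + 0) → (∀ n → b < n → coeff t n ≡ + 0) →
               coeff (p *ₚ t) (a + b) ≡ coeff p a ℤ.* coeff t b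
coeff-*ₚ-top []      t a       b _ _ = sym (ℤ.*-zeroˡ (coeff t b))
coeff-*ₚ-top (x ∷ p) t zero    b p-vanish t-vanish = begin
  coeff (scaleₚ x t +ₚ (+ 0 ∷ p *ₚ t)) b        ≡⟨ coeff-+ₚ (scaleₚ x t) _ b ⟩
  coeff (scaleₚ x t) b ℤ.+ coeff (+ 0 ∷ p *ₚ t) b ≡⟨ cong₂ ℤ._+_ (coeff-scaleₚ x t b) (coeff-≡ (0∷-≋[] p*t≋[]) b) ⟩
  x ℤ.* coeff t b ℤ.+ + 0                        ≡⟨ ℤ.+-identityʳ _ ⟩
  x ℤ.* coeff t b                                ∎
  where
  open ≡-Reasoning
  p*t≋[] : p *ₚ t ≋ []
  p*t≋[] = ≋[]-*ₚ {p} t (mk≋ λ n → p-vanish (suc n) (s≤s z≤n))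
coeff-*ₚ-top (x ∷ p) t (suc a) b p-vanish t-vanish = begin
  coeff (scaleₚ x t +ₚ (+ 0 ∷ p *ₚ t)) (suc a + b)           ≡⟨ coeff-+ₚ (scaleₚ x t) _ (suc a + b) ⟩
  coeff (scaleₚ x t) (suc a + b) ℤ.+ coeff (p *ₚ t) (a + b) ≡⟨ cong₂ ℤ._+_ x*t-vanishes p*t-top ⟩
  + 0 ℤ.+ coeff p a ℤ.* coeff t b                               ≡⟨ ℤ.+-identityˡ _ ⟩
  coeff p a ℤ.* coeff t b                                       ∎
  where
  open ≡-Reasoning
  x*t-vanishes : coeff (scaleₚ x t) (suc a + b) ≡ + 0
  x*t-vanishes = trans (coeff-scaleₚ x t _)
    (trans (cong (x ℤ.*_) (t-vanish _ (s≤s (m≤n+m b a)))) (ℤ.*-zeroʳ x))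
  p*t-top : coeff (p *ₚ t) (a + b) ≡ coeff p a ℤ.* coeff t b
  p*t-top = coeff-*ₚ-top p t a b (λ n a<n → p-vanish (suc n) (s≤s a<n)) t-vanish

oneₚ≉[] : ¬ oneₚ ≋ []
oneₚ≉[] h with coeff-≡ h 0
... | ()

unit⇒constant : ∀ {u V} → u *ₚ V ≋ oneₚ → V ≋ coeff V 0 ∷ []
unit⇒constant {u} {V} uV≋1 with ≋[]⊎HasDegree V | ≋[]⊎HasDegree u
... | inj₁ V≋[] | _ = contradiction (≋-trans (≋-sym uV≋1) (≋-trans (*ₚ-comm u V) (≋[]-*ₚ u V≋[]))) oneₚ≉[]
... | inj₂ _ | inj₁ u≋[] = contradiction (≋-trans (≋-sym uV≋1) (≋[]-*ₚ V u≋[])) oneₚ≉[]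
... | inj₂ (zero , _ , V-vanish) | inj₂ _ =
  mk≋ λ { zero → refl ; (suc n) → V-vanish (suc n) (s≤s z≤n) }
... | inj₂ (suc d , V[d]≢0 , V-vanish) | inj₂ (e , u[e]≢0 , u-vanish) =
  [ flip contradiction u[e]≢0 , flip contradiction V[d]≢0 ]′ (ℤ.i*j≡0⇒i≡0∨j≡0 (coeff u e) top≡0)
  where
  top≡0 : coeff u e ℤ.* coeff V (suc d) ≡ + 0
  top≡0 = begin
    coeff u e ℤ.* coeff V (suc d)   ≡⟨ coeff-*ₚ-top u V e (suc d) u-vanish V-vanish ⟨
    coeff (u *ₚ V) (e + suc d)      ≡⟨ coeff-≡ uV≋1 (e + suc d) ⟩
    coeff oneₚ (e + suc d)          ≡⟨ cong (coeff oneₚ) (+-suc e d) ⟩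
    + 0                             ∎
    where open ≡-Reasoning

-- Negative continued fractions

-- ⟦c, cs⟧ = numer c cs / denom c cs = c − gap cs / denom c cs.
numer denom : ℕ → List ℕ → ℕ
numer c []       = c
numer c (d ∷ ds) = c * numer d ds ∸ denom d ds
denom c []       = 1
denom c (d ∷ ds) = numer d ds

gap : List ℕ → ℕ
gap []       = 0
gap (d ∷ ds) = denom d ds

gap<denom : ∀ c {cs} → All (2 ≤_) cs → gap cs < denom c cs
gap≤c*denom : ∀ {c} cs → 1 ≤ c → All (2 ≤_) cs → gap cs ≤ c * denom c cs
numer+gap : ∀ {c} cs → 1 ≤ c → All (2 ≤_) cs → numer c cs + gap cs ≡ c * denom c cs

gap<denom c []                    = s≤s z≤n
gap<denom c {d ∷ ds} (2≤d ∷ ds≥2) = ≰⇒> numer≰denom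
  where
  numer≰denom : ¬ numer d ds ≤ denom d ds
  numer≰denom n≤s = <-irrefl refl (begin-strict
    d * denom d ds            ≡⟨ numer+gap ds (≤-trans (s≤s z≤n) 2≤d) ds≥2 ⟨
    numer d ds + gap ds       <⟨ +-mono-≤-< n≤s (gap<denom d ds≥2) ⟩
    denom d ds + denom d ds   ≡⟨ cong (_+_ (denom d ds)) (+-identityʳ (denom d ds)) ⟨
    2 * denom d ds            ≤⟨ *-monoˡ-≤ (denom d ds) 2≤d ⟩
    d * denom d ds            ∎)
    where open ≤-Reasoning

gap≤c*denom []       _   _     = z≤n
gap≤c*denom {c} (d ∷ ds) 1≤c cs≥2 = begin
  denom d ds       ≤⟨ <⇒≤ (gap<denom c cs≥2) ⟩
  numer d ds       ≤⟨ m≤n*m (numer d ds) c ⟩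
  c * numer d ds   ∎
  where
  open ≤-Reasoning
  instance c≢0 : NonZero c
  c≢0 = >-nonZero 1≤c

numer+gap []       _   _    = trans (+-identityʳ _) (sym (*-identityʳ _))
numer+gap (d ∷ ds) 1≤c cs≥2 = m∸n+n≡m (gap≤c*denom (d ∷ ds) 1≤c cs≥2)

0<numer : ∀ {c} cs → 1 ≤ c → All (2 ≤_) cs → 0 < numer c cs
0<numer {c} cs 1≤c cs≥2 = ≰⇒> λ numer≤0 → <⇒≱ (gap<denom c cs≥2) (begin
  denom c cs                ≤⟨ m≤n*m (denom c cs) c ⟩
  c * denom c cs            ≡⟨ numer+gap cs 1≤c cs≥2 ⟨
  numer c cs + gap cs       ≡⟨ cong (_+ gap cs) (n≤0⇒n≡0 numer≤0) ⟩
  gap cs                    ∎)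
  where
  open ≤-Reasoning
  instance c≢0 : NonZero c
  c≢0 = >-nonZero 1≤c

denom-nonZero : ∀ c {cs} → All (2 ≤_) cs → NonZero (denom c cs)
denom-nonZero c cs≥2 = >-nonZero (≤-<-trans z≤n (gap<denom c cs≥2))

cfℤ≡numer,denom : ∀ {c} cs → 1 ≤ c → All (2 ≤_) cs → cfℤ c cs ≡ (+ numer c cs , + denom c cs)
cfℤ≡numer,denom []                   _   _                = refl
cfℤ≡numer,denom {c} (d ∷ ds) 1≤c cs≥2@(2≤d ∷ ds≥2)
  rewrite cfℤ≡numer,denom ds (≤-trans (s≤s z≤n) 2≤d) ds≥2 = cong (_, + numer d ds) (begin
    + c ℤ.* + numer d ds - + denom d ds     ≡⟨ cong (_- + denom d ds) (ℤ.pos-* c (numer d ds)) ⟨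
    + (c * numer d ds) - + denom d ds       ≡⟨ ℤ.m-n≡m⊖n (c * numer d ds) (denom d ds) ⟩
    c * numer d ds ℤ.⊖ denom d ds           ≡⟨ ℤ.⊖-≥ (gap≤c*denom (d ∷ ds) 1≤c cs≥2) ⟩
    + (c * numer d ds ∸ denom d ds)         ∎)
  where open ≡-Reasoning

-- Uniqueness of quotient and remainder, except that the remainder 1 + A may equal the divisor P.
quotient-remainder-shift : ∀ {P A B} c c′ → A < P → B < P → c * P + B ≡ c′ * P + suc A →
  (c ≡ c′ × B ≡ suc A) ⊎ (c ≡ suc c′ × B ≡ 0 × P ≡ suc A)
quotient-remainder-shift zero zero _ _ B≡1+A = inj₁ (refl , B≡1+A)
quotient-remainder-shift {P} {A} {B} zero (suc k′) _ B<P h = contradiction P≤B (<⇒≱ B<P)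
  where
  P≤B : P ≤ B
  P≤B = begin
    P                           ≤⟨ m≤m+n P (k′ * P) ⟩
    suc k′ * P                  ≤⟨ m≤m+n (suc k′ * P) (suc A) ⟩
    suc k′ * P + suc A          ≡⟨ h ⟨
    B                           ∎
    where open ≤-Reasoning
quotient-remainder-shift {P} {A} {B} (suc k) zero A<P _ h = inj₂ (cong suc k≡0 , B≡0 , P≡1+A)
  where
  instance P≢0 : NonZero P
  P≢0 = >-nonZero (≤-<-trans z≤n A<P)
  kP+B≡0 : k * P + B ≡ 0
  kP+B≡0 = n≤0⇒n≡0 (+-cancelˡ-≤ P _ 0 (begin
    P + (k * P + B)             ≡⟨ +-assoc P (k * P) B ⟨
    suc k * P + B               ≡⟨ h ⟩
    suc A                       ≤⟨ A<P ⟩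
    P                           ≡⟨ +-identityʳ P ⟨
    P + 0                       ∎))
    where open ≤-Reasoning
  k≡0 : k ≡ 0
  k≡0 = m*n≡0⇒m≡0 k P (m+n≡0⇒m≡0 (k * P) kP+B≡0)
  B≡0 : B ≡ 0
  B≡0 = m+n≡0⇒n≡0 (k * P) kP+B≡0
  P≡1+A : P ≡ suc A
  P≡1+A = begin
    P                           ≡⟨ +-identityʳ P ⟨
    P + 0                       ≡⟨ cong (_+_ P) kP+B≡0 ⟨
    P + (k * P + B)             ≡⟨ +-assoc P (k * P) B ⟨
    suc k * P + B               ≡⟨ h ⟩
    suc A                       ∎
    where open ≡-Reasoning
quotient-remainder-shift {P} {A} {B} (suc k) (suc k′) A<P B<P h =
  ⊎-map (map₁ (cong suc)) (map₁ (cong suc))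
    (quotient-remainder-shift k k′ A<P B<P (+-cancelˡ-≡ P _ _ (trans (sym (+-assoc P (k * P) B)) (trans h (+-assoc P (k′ * P) (suc A))))))

det-as-division : ∀ {r s e c r′ s′ e′ c′} → r + e ≡ c * s → r′ + e′ ≡ c′ * s′ → r * s′ ≡ suc (s * r′) →
  c * (s * s′) + s * e′ ≡ c′ * (s * s′) + suc (e * s′)
det-as-division {r} {s} {e} {c} {r′} {s′} {e′} {c′} r+e≡cs r′+e′≡c′s′ det = begin
  c * (s * s′) + s * e′              ≡⟨ cong (_+ s * e′) (*-assoc c s s′) ⟨
  c * s * s′ + s * e′                ≡⟨ cong (λ x → x * s′ + s * e′) r+e≡cs ⟨
  (r + e) * s′ + s * e′              ≡⟨ cong (_+ s * e′) (*-distribʳ-+ s′ r e) ⟩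
  r * s′ + e * s′ + s * e′           ≡⟨ cong (λ x → x + e * s′ + s * e′) det ⟩
  suc (s * r′) + e * s′ + s * e′     ≡⟨ rearrange s r′ e s′ e′ ⟩
  s * (r′ + e′) + suc (e * s′)       ≡⟨ cong (λ x → s * x + suc (e * s′)) r′+e′≡c′s′ ⟩
  s * (c′ * s′) + suc (e * s′)       ≡⟨ cong (_+ suc (e * s′)) (*-left-comm′ s c′ s′) ⟩
  c′ * (s * s′) + suc (e * s′)       ∎
  where
  open ≡-Reasoning
  rearrange : ∀ s r′ e s′ e′ → suc (s * r′) + e * s′ + s * e′ ≡ s * (r′ + e′) + suc (e * s′)
  rearrange = solve-∀
  *-left-comm′ : ∀ x y z → x * (y * z) ≡ y * (x * z)
  *-left-comm′ = solve-∀

-- q-deformed continued fractions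

numerq denomq : ℕ → List ℕ → Poly
numerq c cs = proj₁ (cfq c cs)
denomq c cs = proj₂ (cfq c cs)

eval1-numerq : ∀ c cs → eval1 (numerq c cs) ≡ proj₁ (cfℤ c cs)
eval1-denomq : ∀ c cs → eval1 (denomq c cs) ≡ proj₂ (cfℤ c cs)

eval1-numerq c []       = eval1-qint c
eval1-numerq c (d ∷ ds) = begin
  eval1 (qint c *ₚ numerq d ds -ₚ qpow (pred c) *ₚ denomq d ds)
    ≡⟨ eval1-+ₚ (qint c *ₚ numerq d ds) _ ⟩
  eval1 (qint c *ₚ numerq d ds) ℤ.+ eval1 (negₚ (qpow (pred c) *ₚ denomq d ds))
    ≡⟨ cong₂ ℤ._+_ (eval1-*ₚ (qint c) (numerq d ds)) (eval1-negₚ (qpow (pred c) *ₚ denomq d ds)) ⟩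
  eval1 (qint c) ℤ.* eval1 (numerq d ds) - eval1 (qpow (pred c) *ₚ denomq d ds)
    ≡⟨ cong₂ (λ x y → x ℤ.* eval1 (numerq d ds) - y) (eval1-qint c) (eval1-*ₚ (qpow (pred c)) (denomq d ds)) ⟩
  + c ℤ.* eval1 (numerq d ds) - eval1 (qpow (pred c)) ℤ.* eval1 (denomq d ds)
    ≡⟨ cong₂ (λ x y → + c ℤ.* x - y ℤ.* eval1 (denomq d ds)) (eval1-numerq d ds) (eval1-qpow (pred c)) ⟩
  + c ℤ.* proj₁ (cfℤ d ds) - + 1 ℤ.* eval1 (denomq d ds)
    ≡⟨ cong (λ x → + c ℤ.* proj₁ (cfℤ d ds) - x) (trans (ℤ.*-identityˡ _) (eval1-denomq d ds)) ⟩
  + c ℤ.* proj₁ (cfℤ d ds) - proj₂ (cfℤ d ds)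
    ∎
  where open ≡-Reasoning

eval1-denomq c []       = refl
eval1-denomq c (d ∷ ds) = eval1-numerq d ds

numerq₀≡1 : ∀ {c cs} → All (2 ≤_) (c ∷ cs) → coeff (numerq c cs) 0 ≡ + 1
numerq₀≡1 {zero}        {_}      (() ∷ _)
numerq₀≡1 {suc zero}    {_ ∷ _}  (s≤s () ∷ _)
numerq₀≡1 {suc c}       {[]}     _                        = refl
numerq₀≡1 {suc (suc c)} {d ∷ ds} (_ ∷ ds≥2@(2≤d ∷ _)) = begin
  coeff (qint (2 + c) *ₚ numerq d ds -ₚ qpow (suc c) *ₚ denomq d ds) 0
    ≡⟨ coeff-+ₚ (qint (2 + c) *ₚ numerq d ds) _ 0 ⟩
  coeff (qint (2 + c) *ₚ numerq d ds) 0 ℤ.+ coeff (negₚ (qpow (suc c) *ₚ denomq d ds)) 0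
    ≡⟨ cong₂ ℤ._+_ (coeff₀-*ₚ (qint (2 + c)) (numerq d ds)) (coeff-negₚ (qpow (suc c) *ₚ denomq d ds) 0) ⟩
  + 1 ℤ.* coeff (numerq d ds) 0 - coeff (qpow (suc c) *ₚ denomq d ds) 0
    ≡⟨ cong₂ (λ x y → + 1 ℤ.* x - y) (numerq₀≡1 ds≥2) (coeff₀-*ₚ (qpow (suc c)) (denomq d ds)) ⟩
  + 1 ℤ.* + 1 - + 0 ℤ.* coeff (denomq d ds) 0
    ≡⟨ cong (λ x → + 1 - x) (ℤ.*-zeroˡ (coeff (denomq d ds) 0)) ⟩
  + 1
    ∎
  where open ≡-Reasoning

-- The step (N, D) ↦ ([c] N − q^(c−1) D, N) has determinant q^(c−1), so gcd(N, D) is a power of q.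
cfq-bézout : ∀ c cs → ∃ λ a → ∃ λ b → ∃ λ m → a *ₚ numerq c cs +ₚ b *ₚ denomq c cs ≋ qpow m
cfq-bézout c []       = [] , oneₚ , 0 , *ₚ-identityˡ oneₚ
cfq-bézout c (d ∷ ds) with cfq-bézout d ds
... | a , b , m , aN+bD≋qᵐ =
  negₚ b , Q *ₚ a +ₚ b *ₚ qint c , pred c + m , (begin
    negₚ b *ₚ (qint c *ₚ N -ₚ Q *ₚ D) +ₚ (Q *ₚ a +ₚ b *ₚ qint c) *ₚ N
      ≈⟨ expand (qint c) Q N D a b ⟩
    Q *ₚ (a *ₚ N +ₚ b *ₚ D)      ≈⟨ *ₚ-congʳ Q aN+bD≋qᵐ ⟩
    Q *ₚ qpow m                  ≈⟨ qpow-+ (pred c) m ⟩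
    qpow (pred c + m)            ∎)
  where
  open SetoidReasoning ≋-setoid
  Q = qpow (pred c)
  N = numerq d ds
  D = denomq d ds
  expand : ∀ C Q N D a b → negₚ b *ₚ (C *ₚ N -ₚ Q *ₚ D) +ₚ (Q *ₚ a +ₚ b *ₚ C) *ₚ N ≋ Q *ₚ (a *ₚ N +ₚ b *ₚ D)
  expand = solve 6 (λ C Q N D a b → (:- b) :* (C :* N :- Q :* D) :+ (Q :* a :+ b :* C) :* N := Q :* (a :* N :+ b :* D)) ≋-refl

proportional⇒common-factor :
  ∀ {N D R S} → coeff N 0 ≡ + 1 → (∃ λ a → ∃ λ b → ∃ λ m → a *ₚ N +ₚ b *ₚ D ≋ qpow m) →
  R *ₚ D ≋ S *ₚ N → ∃ λ V → N *ₚ V ≋ R × D *ₚ V ≋ S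
proportional⇒common-factor {N} {D} {R} {S} N₀≡1 (a , b , m , bézout) RD≋SN = V , NV≋R , DV≋S
  where
  open ConstantTermOne {N} N₀≡1
  open SetoidReasoning ≋-setoid

  expand : ∀ N a R b S → N *ₚ (a *ₚ R +ₚ b *ₚ S) ≋ a *ₚ R *ₚ N +ₚ b *ₚ (S *ₚ N)
  expand = solve 5 (λ N a R b S → N :* (a :* R :+ b :* S) := a :* R :* N :+ b :* (S :* N)) ≋-refl

  collect : ∀ a R N b D → a *ₚ R *ₚ N +ₚ b *ₚ (R *ₚ D) ≋ R *ₚ (a *ₚ N +ₚ b *ₚ D)
  collect = solve 5 (λ a R N b D → a :* R :* N :+ b :* (R :* D) := R :* (a :* N :+ b :* D)) ≋-refl

  N[aR+bS]≋qᵐR : N *ₚ (a *ₚ R +ₚ b *ₚ S) ≋ qpow m *ₚ R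
  N[aR+bS]≋qᵐR = begin
    N *ₚ (a *ₚ R +ₚ b *ₚ S)        ≈⟨ expand N a R b S ⟩
    a *ₚ R *ₚ N +ₚ b *ₚ (S *ₚ N)   ≈⟨ +ₚ-cong (≋-refl {a *ₚ R *ₚ N}) (*ₚ-congʳ b RD≋SN) ⟨
    a *ₚ R *ₚ N +ₚ b *ₚ (R *ₚ D)   ≈⟨ collect a R N b D ⟩
    R *ₚ (a *ₚ N +ₚ b *ₚ D)        ≈⟨ *ₚ-congʳ R bézout ⟩
    R *ₚ qpow m                    ≈⟨ *ₚ-comm R (qpow m) ⟩
    qpow m *ₚ R                    ∎

  V : Poly
  V = proj₁ (*ₚ-qpow-cancel m N[aR+bS]≋qᵐR)

  NV≋R : N *ₚ V ≋ R
  NV≋R = proj₂ (*ₚ-qpow-cancel m N[aR+bS]≋qᵐR)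

  DV≋S : D *ₚ V ≋ S
  DV≋S = *ₚ-cancelˡ (begin
    N *ₚ (D *ₚ V)    ≈⟨ *ₚ-assoc N D V ⟨
    N *ₚ D *ₚ V      ≈⟨ *ₚ-congˡ V (*ₚ-comm N D) ⟩
    D *ₚ N *ₚ V      ≈⟨ *ₚ-assoc D N V ⟩
    D *ₚ (N *ₚ V)    ≈⟨ *ₚ-congʳ D NV≋R ⟩
    D *ₚ R           ≈⟨ *ₚ-comm D R ⟩
    R *ₚ D           ≈⟨ RD≋SN ⟩
    S *ₚ N           ≈⟨ *ₚ-comm S N ⟩
    N *ₚ S           ∎)

positive-unit : ∀ {u v n r} → 0 < n → u ℤ.* v ≡ + 1 → + n ℤ.* v ≡ + r → v ≡ + 1
positive-unit {u} {v} {suc n} _ uv≡1 = unit-cases v ∣v∣≡1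
  where
  ∣v∣≡1 : ℤ.∣ v ∣ ≡ 1
  ∣v∣≡1 = m*n≡1⇒n≡1 ℤ.∣ u ∣ ℤ.∣ v ∣ (trans (sym (ℤ.abs-* u v)) (cong ℤ.∣_∣ uv≡1))
  unit-cases : ∀ v {r} → ℤ.∣ v ∣ ≡ 1 → + suc n ℤ.* v ≡ + r → v ≡ + 1
  unit-cases (+ 1)           _  _  = refl
  unit-cases ℤ.-[1+ 0 ]      _  ()
  unit-cases (+ 0)           () _
  unit-cases (+ suc (suc _)) () _
  unit-cases ℤ.-[1+ suc _ ]  () _

unit-factor≋oneₚ : ∀ {u V N R n r} → u *ₚ V ≋ oneₚ → N *ₚ V ≋ R →
  eval1 N ≡ + n → 0 < n → eval1 R ≡ + r → V ≋ oneₚ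
unit-factor≋oneₚ {u} {V} {N} uV≋1 NV≋R N[1]≡n 0<n R[1]≡r = ≋-trans V≋v (∷-cong v≡1 ≋-refl)
  where
  v : ℤ
  v = coeff V 0
  V≋v : V ≋ v ∷ []
  V≋v = unit⇒constant {u} uV≋1
  V[1]≡v : eval1 V ≡ v
  V[1]≡v = trans (eval1-cong V≋v) (ℤ.+-identityʳ v)
  v≡1 : v ≡ + 1
  v≡1 = positive-unit {eval1 u} 0<n
    (trans (cong (ℤ._*_ (eval1 u)) (sym V[1]≡v)) (trans (sym (eval1-*ₚ u V)) (eval1-cong uV≋1)))
    (trans (cong₂ ℤ._*_ (sym N[1]≡n) (sym V[1]≡v)) (trans (sym (eval1-*ₚ N V)) (trans (eval1-cong NV≋R) R[1]≡r)))

record CFExpansion (r s : ℕ) (R S : Poly) : Set where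
  field
    c         : ℕ
    cs        : List ℕ
    1≤c       : 1 ≤ c
    cs≥2      : All (2 ≤_) cs
    R≋numerq  : R ≋ numerq c cs
    S≋denomq  : S ≋ denomq c cs
    numer≡r   : numer c cs ≡ r
    denom≡s   : denom c cs ≡ s

-- R/S = N/D, with gcd(N, D) a power of q and N(0) = 1, forces (R, S) = V (N, D); V is a unit by
-- coprimality, hence a constant ±1, and R(1) = r ≥ 0 rules out −1.
QRat⇒CFExpansion : ∀ {r s} R S → QRat r s R S → CFExpansion r s R S
QRat⇒CFExpansion {r} {s} R S (c , cs , (entries≥2@(2≤c ∷ cs≥2) , _) , RD≈SN , coprime , eval1R≡r , eval1S≡s) =
  record { c = c ; cs = cs ; 1≤c = 1≤c ; cs≥2 = cs≥2 ; R≋numerq = R≋N ; S≋denomq = S≋D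
         ; numer≡r = ℤ.+-injective (trans (sym eval1N≡numer) (trans (sym (eval1-cong R≋N)) eval1R≡r))
         ; denom≡s = ℤ.+-injective (trans (sym eval1D≡denom) (trans (sym (eval1-cong S≋D)) eval1S≡s)) }
  where
  open SetoidReasoning ≋-setoid
  1≤c : 1 ≤ c
  1≤c = ≤-trans (s≤s z≤n) 2≤c
  N D : Poly
  N = numerq c cs
  D = denomq c cs
  eval1N≡numer : eval1 N ≡ + numer c cs
  eval1N≡numer = trans (eval1-numerq c cs) (cong proj₁ (cfℤ≡numer,denom cs 1≤c cs≥2))
  eval1D≡denom : eval1 D ≡ + denom c cs
  eval1D≡denom = trans (eval1-denomq c cs) (cong proj₂ (cfℤ≡numer,denom cs 1≤c cs≥2))

  common-factor : ∃ λ V → N *ₚ V ≋ R × D *ₚ V ≋ S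
  common-factor = proportional⇒common-factor (numerq₀≡1 entries≥2) (cfq-bézout c cs) (mk≋ RD≈SN)
  V : Poly
  V = proj₁ common-factor
  NV≋R : N *ₚ V ≋ R
  NV≋R = proj₁ (proj₂ common-factor)
  DV≋S : D *ₚ V ≋ S
  DV≋S = proj₂ (proj₂ common-factor)

  V-unit : ∃ λ u → u *ₚ V ≈ₚ oneₚ
  V-unit = coprime V N D (coeff-≡ NV≋R) (coeff-≡ DV≋S)
  V≋1 : V ≋ oneₚ
  V≋1 = unit-factor≋oneₚ {proj₁ V-unit} {V} {N} (mk≋ (proj₂ V-unit)) NV≋R eval1N≡numer (0<numer cs 1≤c cs≥2) eval1R≡r
  R≋N : R ≋ N
  R≋N = begin R ≈⟨ NV≋R ⟨ N *ₚ V ≈⟨ *ₚ-congʳ N V≋1 ⟩ N *ₚ oneₚ ≈⟨ *ₚ-identityʳ N ⟩ N ∎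
  S≋D : S ≋ D
  S≋D = begin S ≈⟨ DV≋S ⟨ D *ₚ V ≈⟨ *ₚ-congʳ D V≋1 ⟩ D *ₚ oneₚ ≈⟨ *ₚ-identityʳ D ⟩ D ∎

-- Farey neighbours

qDet : ℕ → List ℕ → ℕ → List ℕ → Poly
qDet c cs c′ cs′ = numerq c cs *ₚ denomq c′ cs′ -ₚ denomq c cs *ₚ numerq c′ cs′

qDet-[]-∷[] : ∀ c d′ → qDet c [] c (d′ ∷ []) ≋ qpow (pred c)
qDet-[]-∷[] c d′ = identity (qint c) (qint d′) (qpow (pred c))
  where
  identity : ∀ C D Q → C *ₚ D -ₚ oneₚ *ₚ (C *ₚ D -ₚ Q *ₚ oneₚ) ≋ Q
  identity = solve 3 (λ C D Q → C :* D :- con (+ 1) :* (C :* D :- Q :* con (+ 1)) := Q) ≋-refl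

qDet-∷-∷ : ∀ c d ds d′ ds′ → qDet c (d ∷ ds) c (d′ ∷ ds′) ≋ qpow (pred c) *ₚ qDet d ds d′ ds′
qDet-∷-∷ c d ds d′ ds′ = identity (qint c) (qpow (pred c)) (numerq d ds) (denomq d ds) (numerq d′ ds′) (denomq d′ ds′)
  where
  identity : ∀ C Q A B A′ B′ → (C *ₚ A -ₚ Q *ₚ B) *ₚ A′ -ₚ A *ₚ (C *ₚ A′ -ₚ Q *ₚ B′) ≋ Q *ₚ (A *ₚ B′ -ₚ B *ₚ A′)
  identity = solve 6 (λ C Q A B A′ B′ → (C :* A :- Q :* B) :* A′ :- A :* (C :* A′ :- Q :* B′) := Q :* (A :* B′ :- B :* A′)) ≋-refl

qDet-suc-[]-[] : ∀ c′ → qDet (suc c′) [] c′ [] ≋ qpow c′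
qDet-suc-[]-[] c′ = begin
  qint (suc c′) *ₚ oneₚ -ₚ oneₚ *ₚ qint c′              ≈⟨ +ₚ-cong (*ₚ-congˡ oneₚ (qint-suc c′)) ≋-refl ⟩
  (qint c′ +ₚ qpow c′) *ₚ oneₚ -ₚ oneₚ *ₚ qint c′       ≈⟨ identity (qint c′) (qpow c′) ⟩
  qpow c′                                              ∎
  where
  open SetoidReasoning ≋-setoid
  identity : ∀ C Q → (C +ₚ Q) *ₚ oneₚ -ₚ oneₚ *ₚ C ≋ Q
  identity = solve 2 (λ C Q → (C :+ Q) :* con (+ 1) :- con (+ 1) :* C := Q) ≋-refl

qDet-suc-∷-[] : ∀ c′ d ds → qDet (suc c′) (d ∷ ds) c′ [] ≋ qpow c′ *ₚ qDet d ds 1 []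
qDet-suc-∷-[] c′ d ds = begin
  (qint (suc c′) *ₚ A -ₚ qpow c′ *ₚ B) *ₚ oneₚ -ₚ A *ₚ qint c′
    ≈⟨ +ₚ-cong (*ₚ-congˡ oneₚ (+ₚ-cong (*ₚ-congˡ A (qint-suc c′)) ≋-refl)) ≋-refl ⟩
  ((qint c′ +ₚ qpow c′) *ₚ A -ₚ qpow c′ *ₚ B) *ₚ oneₚ -ₚ A *ₚ qint c′
    ≈⟨ identity (qint c′) (qpow c′) A B ⟩
  qpow c′ *ₚ (A *ₚ oneₚ -ₚ B *ₚ oneₚ)
    ∎
  where
  open SetoidReasoning ≋-setoid
  A = numerq d ds
  B = denomq d ds
  identity : ∀ C Q A B → ((C +ₚ Q) *ₚ A -ₚ Q *ₚ B) *ₚ oneₚ -ₚ A *ₚ C ≋ Q *ₚ (A *ₚ oneₚ -ₚ B *ₚ oneₚ)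
  identity = solve 4 (λ C Q A B → ((C :+ Q) :* A :- Q :* B) :* con (+ 1) :- A :* C := Q :* (A :* con (+ 1) :- B :* con (+ 1))) ≋-refl

qpow-multiple : ∀ a {X Y} → X ≋ qpow a *ₚ Y → (∃ λ b → Y ≋ qpow b) → ∃ λ β → X ≋ qpow β
qpow-multiple a X≋qᵃY (b , Y≋qᵇ) = a + b , ≋-trans X≋qᵃY (≋-trans (*ₚ-congʳ (qpow a) Y≋qᵇ) (qpow-+ a b))

-- Write r/s = c − e/s and r′/s′ = c′ − e′/s′ with 0 ≤ e < s, 0 ≤ e′ < s′ (so c = ⌈r/s⌉).
-- Then r s′ − s r′ = 1 reads c (s s′) + s e′ = c′ (s s′) + (1 + e s′): two divisions by s s′.
leading-entries : ∀ {c c′} cs cs′ → 1 ≤ c → All (2 ≤_) cs → 1 ≤ c′ → All (2 ≤_) cs′ →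
  numer c cs * denom c′ cs′ ≡ suc (denom c cs * numer c′ cs′) →
  (c ≡ c′ × denom c cs * gap cs′ ≡ suc (gap cs * denom c′ cs′)) ⊎
  (c ≡ suc c′ × denom c cs * gap cs′ ≡ 0 × denom c cs * denom c′ cs′ ≡ suc (gap cs * denom c′ cs′))
leading-entries {c} {c′} cs cs′ 1≤c cs≥2 1≤c′ cs′≥2 det =
  quotient-remainder-shift c c′ (*-monoˡ-< s′ e<s) (*-monoʳ-< s e′<s′)
    (det-as-division {r} {s} {e} {c} {r′} {s′} {e′} {c′} (numer+gap cs 1≤c cs≥2) (numer+gap cs′ 1≤c′ cs′≥2) det)
  where
  r = numer c cs
  s = denom c cs
  e = gap cs
  r′ = numer c′ cs′
  s′ = denom c′ cs′
  e′ = gap cs′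
  e<s : e < s
  e<s = gap<denom c cs≥2
  e′<s′ : e′ < s′
  e′<s′ = gap<denom c′ cs′≥2
  instance
    s≢0 : NonZero s
    s≢0 = denom-nonZero c cs≥2
    s′≢0 : NonZero s′
    s′≢0 = denom-nonZero c′ cs′≥2

qDet≋qpow : ∀ {c c′} cs cs′ → 1 ≤ c → All (2 ≤_) cs → 1 ≤ c′ → All (2 ≤_) cs′ →
  numer c cs * denom c′ cs′ ≡ suc (denom c cs * numer c′ cs′) → ∃ λ β → qDet c cs c′ cs′ ≋ qpow β

qDet≋qpow-same-leading : ∀ {c} cs cs′ → 1 ≤ c → All (2 ≤_) cs → All (2 ≤_) cs′ →
  denom c cs * gap cs′ ≡ suc (gap cs * denom c cs′) → ∃ λ β → qDet c cs c cs′ ≋ qpow β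

-- Here r′/s′ = c′ and the tail of r/s is a neighbour of 1 = ⟦1⟧: this is why leading entries 1 are admitted.
qDet≋qpow-next-leading : ∀ {c′} cs cs′ → All (2 ≤_) cs → All (2 ≤_) cs′ →
  denom (suc c′) cs * gap cs′ ≡ 0 → denom (suc c′) cs * denom c′ cs′ ≡ suc (gap cs * denom c′ cs′) →
  ∃ λ β → qDet (suc c′) cs c′ cs′ ≋ qpow β

qDet≋qpow {c} {c′} cs cs′ 1≤c cs≥2 1≤c′ cs′≥2 det
  with leading-entries cs cs′ 1≤c cs≥2 1≤c′ cs′≥2 det
... | inj₁ (refl , h)       = qDet≋qpow-same-leading cs cs′ 1≤c cs≥2 cs′≥2 h
... | inj₂ (refl , h₀ , h₁) = qDet≋qpow-next-leading cs cs′ cs≥2 cs′≥2 h₀ h₁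

qDet≋qpow-same-leading     []       []                  _   _ _ ()
qDet≋qpow-same-leading {c} []       (d′ ∷ [])           _   _ _ _ = pred c , qDet-[]-∷[] c d′
qDet≋qpow-same-leading     []       (d′ ∷ f ∷ fs)       _   _ (_ ∷ 2≤f ∷ fs≥2) h =
  contradiction (trans (sym (+-identityʳ (numer f fs))) h) (>⇒≢ 1<numer)
  where
  instance _ = denom-nonZero f fs≥2
  1<numer : 1 < numer f fs
  1<numer = ≤-<-trans (>-nonZero⁻¹ (denom f fs)) (gap<denom d′ (2≤f ∷ fs≥2))
qDet≋qpow-same-leading     (d ∷ ds) []                  _   _ _ h = contradiction (trans (sym (*-zeroʳ (numer d ds))) h) 0≢1+n
qDet≋qpow-same-leading {c} (d ∷ ds) (d′ ∷ ds′) _ (2≤d ∷ ds≥2) (2≤d′ ∷ ds′≥2) h =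
  qpow-multiple (pred c) (qDet-∷-∷ c d ds d′ ds′)
    (qDet≋qpow ds ds′ (≤-trans (s≤s z≤n) 2≤d) ds≥2 (≤-trans (s≤s z≤n) 2≤d′) ds′≥2 h)

qDet≋qpow-next-leading {c′} []       []        _             _ _ _ = c′ , qDet-suc-[]-[] c′
qDet≋qpow-next-leading {c′} (d ∷ ds) []        (2≤d ∷ ds≥2) _ _ h =
  qpow-multiple c′ (qDet-suc-∷-[] c′ d ds) (qDet≋qpow ds [] (≤-trans (s≤s z≤n) 2≤d) ds≥2 (s≤s z≤n) [] h)
qDet≋qpow-next-leading {c′} cs       (d′ ∷ ds′) cs≥2        (_ ∷ ds′≥2) h₀ _ =
  contradiction h₀ (≢-nonZero⁻¹ (denom (suc c′) cs * denom d′ ds′))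
  where instance
  _ = denom-nonZero (suc c′) cs≥2
  _ = denom-nonZero d′ ds′≥2
  _ = m*n≢0 (denom (suc c′) cs) (denom d′ ds′)

eval1-cross : ∀ P Q P′ Q′ → eval1 (P *ₚ Q′ -ₚ Q *ₚ P′) ≡ eval1 P ℤ.* eval1 Q′ - eval1 Q ℤ.* eval1 P′
eval1-cross P Q P′ Q′ = trans (eval1-+ₚ (P *ₚ Q′) (negₚ (Q *ₚ P′)))
  (cong₂ ℤ._+_ (eval1-*ₚ P Q′) (trans (eval1-negₚ (Q *ₚ P′)) (cong ℤ.-_ (eval1-*ₚ Q P′))))

[+m]-[+n]≡1⇒m≡1+n : ∀ {m n} → + m - + n ≡ + 1 → m ≡ suc n
[+m]-[+n]≡1⇒m≡1+n {m} {n} m-n≡1 = ℤ.+-injective (begin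
  + m                    ≡⟨ i≡[i-j]+j (+ m) (+ n) ⟩
  (+ m - + n) ℤ.+ + n    ≡⟨ cong (ℤ._+ + n) m-n≡1 ⟩
  + suc n                ∎)
  where
  open ≡-Reasoning
  i≡[i-j]+j : ∀ i j → i ≡ (i - j) ℤ.+ j
  i≡[i-j]+j = ℤ-solve-∀

cross≋qpow⇒det≡1 : ∀ {r s r′ s′} R S R′ S′ → QRat r s R S → QRat r′ s′ R′ S′ →
  ∀ α → R *ₚ S′ -ₚ S *ₚ R′ ≋ qpow α → + (r * s′) - + (r′ * s) ≡ + 1
cross≋qpow⇒det≡1 {r} {s} {r′} {s′} R S R′ S′
  (_ , _ , _ , _ , _ , R[1]≡r , S[1]≡s) (_ , _ , _ , _ , _ , R′[1]≡r′ , S′[1]≡s′) α cross≋qᵅ = begin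
  + (r * s′) - + (r′ * s)                        ≡⟨ cong (λ x → + (r * s′) - + x) (*-comm r′ s) ⟩
  + (r * s′) - + (s * r′)                        ≡⟨ cong₂ _-_ (ℤ.pos-* r s′) (ℤ.pos-* s r′) ⟩
  + r ℤ.* + s′ - + s ℤ.* + r′                    ≡⟨ cong₂ (λ x y → x ℤ.* y - + s ℤ.* + r′) R[1]≡r S′[1]≡s′ ⟨
  eval1 R ℤ.* eval1 S′ - + s ℤ.* + r′            ≡⟨ cong₂ (λ x y → eval1 R ℤ.* eval1 S′ - x ℤ.* y) S[1]≡s R′[1]≡r′ ⟨
  eval1 R ℤ.* eval1 S′ - eval1 S ℤ.* eval1 R′    ≡⟨ eval1-cross R S R′ S′ ⟨
  eval1 (R *ₚ S′ -ₚ S *ₚ R′)                     ≡⟨ eval1-cong cross≋qᵅ ⟩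
  eval1 (qpow α)                                 ≡⟨ eval1-qpow α ⟩
  + 1                                            ∎
  where open ≡-Reasoning

neighbours⇒cross≋qpow : ∀ {r s r′ s′} R S R′ S′ → QRat r s R S → QRat r′ s′ R′ S′ →
  r * s′ ≡ suc (r′ * s) → ∃ λ α → R *ₚ S′ -ₚ S *ₚ R′ ≋ qpow α
neighbours⇒cross≋qpow {r} {s} {r′} {s′} R S R′ S′ qR qR′ r*s′≡1+r′*s =
  map₂ (≋-trans cross≋qDet) (qDet≋qpow E.cs E′.cs E.1≤c E.cs≥2 E′.1≤c E′.cs≥2 det)
  where
  module E  = CFExpansion (QRat⇒CFExpansion R S qR)
  module E′ = CFExpansion (QRat⇒CFExpansion R′ S′ qR′)
  cross≋qDet : R *ₚ S′ -ₚ S *ₚ R′ ≋ qDet E.c E.cs E′.c E′.cs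
  cross≋qDet = +ₚ-cong (*ₚ-cong E.R≋numerq E′.S≋denomq) (negₚ-cong (*ₚ-cong E.S≋denomq E′.R≋numerq))
  det : numer E.c E.cs * denom E′.c E′.cs ≡ suc (denom E.c E.cs * numer E′.c E′.cs)
  det = begin
    numer E.c E.cs * denom E′.c E′.cs           ≡⟨ cong₂ _*_ E.numer≡r E′.denom≡s ⟩
    r * s′                                      ≡⟨ r*s′≡1+r′*s ⟩
    suc (r′ * s)                                ≡⟨ cong suc (*-comm r′ s) ⟩
    suc (s * r′)                                ≡⟨ cong suc (cong₂ _*_ E.denom≡s E′.numer≡r) ⟨
    suc (denom E.c E.cs * numer E′.c E′.cs)     ∎
    where open ≡-Reasoning

corollary1p6 : (r s r' s' : ℕ) (R S R' S' : Poly) →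
    1 ≤ s → 1 ≤ s' → Coprime r s → Coprime r' s' →
    s < r → s' < r' → r' * s < r * s' →
    QRat r s R S → QRat r' s' R' S' →
    ((∃ λ α → R *ₚ S' -ₚ S *ₚ R' ≈ₚ qpow α) ⇔ (+ (r * s') - + (r' * s) ≡ + 1))
corollary1p6 r s r' s' R S R' S' _ _ _ _ _ _ _ qR qR' = mk⇔
  (λ (α , cross≈qᵅ) → cross≋qpow⇒det≡1 R S R' S' qR qR' α (mk≋ cross≈qᵅ))
  (λ det → map₂ coeff-≡ (neighbours⇒cross≋qpow R S R' S' qR qR' ([+m]-[+n]≡1⇒m≡1+n det)))
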